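{- Let $\Sigma$ be a finite alphabet of size $\sigma\ge2$ and $k\ge2$. Let $G_{\mathrm{PCR}}$ be the directed graph whose nodes are the PCR sets of $D_k$ that are not decycling, with an edge $M\to fM$ whenever $f\in\Sigma^{k-1}$ satisfies $\mathrm{lc}(f)\subseteq M$ and both $M$ and $fM$ are nodes. Then $G_{\mathrm{PCR}}$ contains no directed cycle, i.e., each of its components is a DAG.
   Context: $D_k$ is the de Bruijn graph with vertex set $\Sigma^k$ and edges $u\to v$ whenever the length-$(k-1)$ suffix of $u$ equals the length-$(k-1)$ prefix of $v$. A set $M\subseteq\Sigma^k$ is decycling if $D_k\setminus M$ has no directed cycle. A pure cycling register (PCR) is an equivalence class of $k$-mers under cyclic rotation (e.g. $1011,0111,1110,1101$); a PCR set is a set of $k$-mers containing exactly one $k$-mer from each PCR. For $f\in\Sigma^{k-1}$, $\mathrm{lc}(f)=\{af:a\in\Sigma\}$, $\mathrm{rc}(f)=\{fa:a\in\Sigma\}$, and $fM=(M\setminus\mathrm{lc}(f))\cup\mathrm{rc}(f)$ (an F-move). -}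

module Defs where

open import Data.Nat using (ℕ; zero; suc)
open import Data.Bool using (Bool; true; false; _∧_; _∨_; not)
open import Data.Fin using (Fin)
import Data.Fin.Properties as FinP
open import Data.Vec using (Vec; _∷_; _∷ʳ_; head; tail; init)
open import Data.Vec.Properties using (≡-dec)
open import Data.Product using (Σ; _×_; ∃)
open import Relation.Nullary using (¬_; does)
open import Relation.Binary.PropositionalEquality using (_≡_)

-- Alphabet Σ = Fin σ; k-mers are words of length k = suc m  (so k ≥ 2 ⇔ m ≥ 1).
module DB (σ m : ℕ) where

  Word : ℕ → Set
  Word n = Vec (Fin σ) n

  KMer : Set
  KMer = Word (suc m)

  KSet : Set
  KSet = KMer → Bool

  DEdge : KMer → KMer → Set
  DEdge u v = tail u ≡ init v

  data Path (M : KSet) : KMer → KMer → Set where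
    edge : ∀ {u v} → M u ≡ false → M v ≡ false → DEdge u v → Path M u v
    step : ∀ {u w v} → M u ≡ false → DEdge u w → Path M w v → Path M u v

  HasCycleOutside : KSet → Set
  HasCycleOutside M = Σ KMer λ v → Path M v v

  Decycling : KSet → Set
  Decycling M = ¬ HasCycleOutside M

  rot : KMer → KMer
  rot u = tail u ∷ʳ head u

  rotN : ℕ → KMer → KMer
  rotN zero u = u
  rotN (suc j) u = rot (rotN j u)

  SamePCR : KMer → KMer → Set
  SamePCR u v = ∃ λ j → rotN j u ≡ v

  IsPCRSet : KSet → Set
  IsPCRSet M =
    ((u : KMer) → Σ KMer λ v → M v ≡ true × SamePCR u v) ×
    ((v w : KMer) → M v ≡ true → M w ≡ true → SamePCR v w → v ≡ w)

  _≟w_ : (x y : Word m) → Relation.Nullary.Dec (x ≡ y)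
  _≟w_ = ≡-dec FinP._≟_

  -- x ∈ lc(f)  ⇔  x = a f ;  x ∈ rc(f)  ⇔  x = f a
  inLC : Word m → KMer → Bool
  inLC f x = does (tail x ≟w f)

  inRC : Word m → KMer → Bool
  inRC f x = does (init x ≟w f)

  LCSubset : Word m → KSet → Set
  LCSubset f M = (a : Fin σ) → M (a ∷ f) ≡ true

  FMove : Word m → KSet → KSet
  FMove f M x = inRC f x ∨ (M x ∧ not (inLC f x))

  Node : KSet → Set
  Node M = IsPCRSet M × ¬ Decycling M

  -- edges of G_PCR (target given up to extensional equality of sets)
  GEdge : KSet → KSet → Set
  GEdge M N = Σ (Word m) λ f →
    LCSubset f M × Node M × Node N × ((x : KMer) → N x ≡ FMove f M x)

{-# OPTIONS --safe #-}
-- Follow a closed walk M = M₀ → M₁ → ⋯ → Mᵣ = M in G_PCR and call the words f of the F-moves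
-- performed its labels.  If f is a label but its shift f' = f[2..k-1]a is not, the k-mer fa is added
-- by the f-move and never removed again, so fa ∈ M.  Then fa survives from M₀ to the f-move, where
-- af ∈ lc(f) lies in the same PCR set; as af and fa are rotations of each other, af = fa and f' = f.  Labels are thus
-- closed under shifting, and since D_{k-1} is strongly connected every (k-1)-mer is a label.  But an
-- F-move with lc(f) ⊆ M keeps every cycle of D_k ∖ M, and while D_k ∖ Mᵢ has a cycle through v the
-- label init(v) cannot be used (the predecessor of v on the cycle lies in lc(init v)).  As M₀ is not
-- decycling, this is a contradiction.
module Submission where

open import Defs
open import Data.Nat using (ℕ; zero; suc; _≤_)
open import Data.Empty using (⊥; ⊥-elim)
open import Data.Bool using (true; false)
open import Data.Bool.Properties using (∨-zeroʳ)
open import Data.Product using (∃; _×_; _,_; proj₁; proj₂)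
open import Data.List using (List; []; _∷_)
open import Data.List.Relation.Unary.Any using (here; there)
open import Function using (_∘_)
open import Data.Vec using (Vec; []; _∷_; _∷ʳ_; tail; init; initLast)
open import Data.Vec.Properties using (init-∷ʳ)
open import Relation.Nullary using (¬_; yes; no)
open import Relation.Nullary.Decidable using (dec-true; dec-false)
open import Relation.Binary.PropositionalEquality using (_≡_; refl; sym; trans; cong; subst)
open import Relation.Binary.Construct.Closure.Transitive using (TransClosure; [_]; _∷_)

shift-closed⇒universal : ∀ {A : Set} n (P : Vec A n → Set) →
  (∀ x a → P x → P (tail (x ∷ʳ a))) → ∃ P → ∀ y → P y
shift-closed⇒universal zero    P _     ([] , p) [] = p
shift-closed⇒universal (suc n) P shift (x ∷ xs , p) y with initLast y
... | ys , a , refl = let c , q = extendable ys in shift (c ∷ ys) a q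
  where
  Extendable : Vec _ n → Set
  Extendable w = ∃ λ c → P (c ∷ w)

  shift-extendable : ∀ w a → Extendable w → Extendable (tail (w ∷ʳ a))
  shift-extendable []       a (c , p) = a  , shift (c ∷ []) a p
  shift-extendable (w ∷ ws) a (c , p) = w , shift (c ∷ w ∷ ws) a p

  extendable : ∀ w → Extendable w
  extendable = shift-closed⇒universal n Extendable shift-extendable (xs , x , p)

module Acyclicity (σ m : ℕ) where
  open DB σ m
  open import Data.List.Membership.DecPropositional _≟w_ using (_∈_; _∉_; _∈?_)

  FMove-keeps : ∀ f M v → ¬ tail v ≡ f → M v ≡ true → FMove f M v ≡ true
  FMove-keeps f M v v∉lc v∈M rewrite v∈M | dec-false (tail v ≟w f) v∉lc = ∨-zeroʳ (inRC f v)

  FMove-adds : ∀ f M v → init v ≡ f → FMove f M v ≡ true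
  FMove-adds f M v v∈rc rewrite dec-true (init v ≟w f) v∈rc = refl

  lc-member : ∀ {f M} → LCSubset f M → ∀ u → tail u ≡ f → M u ≡ true
  lc-member lc (a ∷ _) refl = lc a

  true≢false : ¬ true ≡ false
  true≢false ()

  predecessor : ∀ {M u v} → Path M u v → ∃ λ p → M p ≡ false × DEdge p v
  predecessor (edge u∉M _ u→v) = _ , u∉M , u→v
  predecessor (step _ _ path)  = predecessor path

  path-target-lc : ∀ {M u v} → Path M u v → ¬ LCSubset (init v) M
  path-target-lc {M} {v = v} path lc with predecessor path
  ... | p , p∉M , p→v = true≢false (trans (sym (lc-member {init v} {M} lc p p→v)) p∉M)

  module _ {f M} (lc : LCSubset f M) where

    -- Every predecessor of a k-mer in rc(f) lies in lc(f) ⊆ M.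
    FMove-keeps-outside : ∀ {u v} → M u ≡ false → DEdge u v → M v ≡ false → FMove f M v ≡ false
    FMove-keeps-outside {u} {v} u∉M u→v v∉M with init v ≟w f
    ... | yes v∈rc = ⊥-elim (true≢false (trans (sym (lc-member {f} {M} lc u (trans u→v v∈rc))) u∉M))
    ... | no _ rewrite v∉M = refl

    path-FMove : ∀ {u v w} → M u ≡ false → DEdge u v → Path M v w → Path (FMove f M) v w
    path-FMove u∉M u→v (edge v∉M w∉M v→w) =
      edge (FMove-keeps-outside u∉M u→v v∉M) (FMove-keeps-outside v∉M v→w w∉M) v→w
    path-FMove u∉M u→v (step v∉M v→x path) =
      step (FMove-keeps-outside u∉M u→v v∉M) v→x (path-FMove v∉M v→x path)

    cycle-FMove : ∀ {v} → Path M v v → Path (FMove f M) v v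
    cycle-FMove cycle with predecessor cycle
    ... | _ , u∉M , u→v = path-FMove u∉M u→v cycle

  path-cong : ∀ {M N u v} → (∀ x → N x ≡ M x) → Path M u v → Path N u v
  path-cong N≗M (edge u∉M v∉M u→v) = edge (trans (N≗M _) u∉M) (trans (N≗M _) v∉M) u→v
  path-cong N≗M (step u∉M u→w path) = step (trans (N≗M _) u∉M) u→w (path-cong N≗M path)

  label : ∀ {M N} → GEdge M N → Word m
  label = proj₁

  edge-keeps : ∀ {M N} (e : GEdge M N) v → ¬ tail v ≡ label e → M v ≡ true → N v ≡ true
  edge-keeps {M} (f , _ , _ , _ , N≗fM) v v∉lc v∈M = trans (N≗fM v) (FMove-keeps f M v v∉lc v∈M)

  edge-adds : ∀ {M N} (e : GEdge M N) v → init v ≡ label e → N v ≡ true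
  edge-adds {M} (f , _ , _ , _ , N≗fM) v v∈rc = trans (N≗fM v) (FMove-adds f M v v∈rc)

  edge-rotation : ∀ {M N} (e : GEdge M N) f a → f ≡ label e → M (f ∷ʳ a) ≡ true → a ∷ f ≡ f ∷ʳ a
  edge-rotation {M} (_ , lc , ((_ , unique) , _) , _) f a refl fa∈M =
    unique (a ∷ f) (f ∷ʳ a) (lc a) fa∈M (1 , refl)

  edge-cycle : ∀ {M N v} → GEdge M N → Path M v v → Path N v v
  edge-cycle (_ , lc , _ , _ , N≗fM) cycle = path-cong N≗fM (cycle-FMove lc cycle)

  edge-cycle-label : ∀ {M N v} (e : GEdge M N) → Path M v v → ¬ init v ≡ label e
  edge-cycle-label (_ , lc , _) cycle refl = path-target-lc cycle lc

  Chain : KSet → KSet → Set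
  Chain = TransClosure GEdge

  labels : ∀ {M N} → Chain M N → List (Word m)
  labels [ e ]   = label e ∷ []
  labels (e ∷ c) = label e ∷ labels c

  source-node : ∀ {M N} → Chain M N → Node M
  source-node [ _ , _ , M-node , _ ]   = M-node
  source-node ((_ , _ , M-node , _) ∷ _) = M-node

  chain-keeps : ∀ {M N} (c : Chain M N) v → tail v ∉ labels c → M v ≡ true → N v ≡ true
  chain-keeps [ e ]   v v∉lc v∈M = edge-keeps e v (v∉lc ∘ here) v∈M
  chain-keeps (e ∷ c) v v∉lc v∈M = chain-keeps c v (v∉lc ∘ there) (edge-keeps e v (v∉lc ∘ here) v∈M)

  chain-adds : ∀ {M N} (c : Chain M N) v → tail v ∉ labels c → init v ∈ labels c → N v ≡ true
  chain-adds [ e ]   v _    (here v∈rc)  = edge-adds e v v∈rc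
  chain-adds (e ∷ c) v v∉lc (here v∈rc)  = chain-keeps c v (v∉lc ∘ there) (edge-adds e v v∈rc)
  chain-adds (e ∷ c) v v∉lc (there v∈rc) = chain-adds c v (v∉lc ∘ there) v∈rc

  chain-rotation : ∀ {M N} (c : Chain M N) f a → tail (f ∷ʳ a) ∉ labels c → f ∈ labels c →
                   M (f ∷ʳ a) ≡ true → a ∷ f ≡ f ∷ʳ a
  chain-rotation [ e ]   f a _    (here f≡e)  fa∈M = edge-rotation e f a f≡e fa∈M
  chain-rotation (e ∷ c) f a _    (here f≡e)  fa∈M = edge-rotation e f a f≡e fa∈M
  chain-rotation (e ∷ c) f a fa∉lc (there f∈c) fa∈M =
    chain-rotation c f a (fa∉lc ∘ there) f∈c (edge-keeps e (f ∷ʳ a) (fa∉lc ∘ here) fa∈M)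

  chain-cycle-label : ∀ {M N v} (c : Chain M N) → Path M v v → init v ∉ labels c
  chain-cycle-label [ e ]   cycle (here v∈rc)  = edge-cycle-label e cycle v∈rc
  chain-cycle-label (e ∷ c) cycle (here v∈rc)  = edge-cycle-label e cycle v∈rc
  chain-cycle-label (e ∷ c) cycle (there v∈rc) = chain-cycle-label c (edge-cycle e cycle) v∈rc

  closed-chain-labels-shift-closed : ∀ {M N} (c : Chain M N) → (∀ x → M x ≡ N x) →
                                     ∀ f a → f ∈ labels c → tail (f ∷ʳ a) ∈ labels c
  closed-chain-labels-shift-closed {M} {N} c M≗N f a f∈c with tail (f ∷ʳ a) ∈? labels c
  ... | yes f′∈c = f′∈c
  ... | no f′∉c = subst (_∈ labels c) (cong tail fa-rotation) f∈c
    where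
    fa∈N : N (f ∷ʳ a) ≡ true
    fa∈N = chain-adds c (f ∷ʳ a) f′∉c (subst (_∈ labels c) (sym (init-∷ʳ a f)) f∈c)

    fa-rotation : a ∷ f ≡ f ∷ʳ a
    fa-rotation = chain-rotation c f a f′∉c f∈c (trans (M≗N (f ∷ʳ a)) fa∈N)

  labels-nonempty : ∀ {M N} (c : Chain M N) → ∃ (_∈ labels c)
  labels-nonempty [ e ]   = label e , here refl
  labels-nonempty (e ∷ _) = label e , here refl

  closed-chain-labels-universal : ∀ {M N} (c : Chain M N) → (∀ x → M x ≡ N x) → ∀ g → g ∈ labels c
  closed-chain-labels-universal c M≗N = shift-closed⇒universal m (_∈ labels c)
    (closed-chain-labels-shift-closed c M≗N) (labels-nonempty c)

  closed-chain-absurd : ∀ {M N} → Chain M N → (∀ x → M x ≡ N x) → ⊥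
  closed-chain-absurd c M≗N = proj₂ (source-node c) λ (v , cycle) →
    chain-cycle-label c cycle (closed-chain-labels-universal c M≗N (init v))

proposition8 : (σ m : ℕ) → 2 ≤ σ → 2 ≤ suc m →
    (M N : DB.KSet σ m) → TransClosure (DB.GEdge σ m) M N →
    ((x : DB.KMer σ m) → M x ≡ N x) → ⊥
proposition8 σ m _ _ M N = Acyclicity.closed-chain-absurd σ m
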